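{- Let $\mathfrak{k}_{\mathbb{Z}_{25}}$ be the set of the following $21$ points of $\mathrm{PHG}(2,\mathbb{Z}_{25})$: $(1:1:4)$, $(1:19:19)$, $(1:4:1)$, $(1:1:22)$, $(1:8:8)$, $(1:22:1)$, $(1:3:12)$, $(1:23:19)$, $(1:4:17)$, $(1:7:8)$, $(1:22:4)$, $(1:19:18)$, $(1:7:22)$, $(1:8:6)$, $(1:21:18)$, $(5:1:2)$, $(1:15:13)$, $(1:2:5)$, $(5:1:23)$, $(1:10:12)$, $(1:23:5)$. Then the automorphism group of $\mathfrak{k}_{\mathbb{Z}_{25}}$ has order $3$ and is generated by the collineation $\rho:\langle v\rangle\mapsto\langle Mv\rangle$ with $M=\begin{pmatrix}0&1&0\\0&0&1\\1&0&0\end{pmatrix}$. The $21$ points lie in $21$ pairwise distinct point neighbor classes, and the complement of $\phi(\mathfrak{k}_{\mathbb{Z}_{25}})$ in $\mathrm{PG}(2,\mathbb{F}_5)$ consists of the $10$ points $\bigcup_{a\in\mathbb{F}_5}\{(0:1:-a^2),(1:-a^2:0),(-a^2:0:1)\}\cup\{(1:1:1)\}$.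
   Context: $\mathrm{PHG}(2,R)$ for a finite chain ring $R$: points are free rank-$1$ right submodules of $R^3$, lines are free rank-$2$ right submodules, incidence is inclusion; $(a:b:c)$ denotes the submodule generated by $(a,b,c)^T$ (some coordinate a unit). The collineation group of $\mathrm{PHG}(2,R)$ is $\mathrm{P\Gamma L}(3,R)$, and the automorphism group of a point set is its setwise stabilizer in this group (for $\mathbb{Z}_{25}$, whose ring automorphism group is trivial, this is $\mathrm{PGL}(3,\mathbb{Z}_{25})$). $\phi:\mathbb{Z}_{25}\to\mathbb{F}_5$ is reduction modulo $5$, extended coordinatewise to a map from points of $\mathrm{PHG}(2,\mathbb{Z}_{25})$ to points of $\mathrm{PG}(2,\mathbb{F}_5)$; the point neighbor classes are the fibres $\phi^{ -1}(P)$, $P$ a point of $\mathrm{PG}(2,\mathbb{F}_5)$. -}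

module Defs where

open import Data.Nat as ℕ using (ℕ; NonZero)
open import Data.Nat.DivMod using (_mod_)
open import Data.Fin using (Fin; toℕ; #_; zero; suc)
open import Data.Product using (Σ; ∃; ∃-syntax; _×_; _,_)
open import Data.Sum using (_⊎_)
open import Relation.Binary.PropositionalEquality using (_≡_; _≢_)
open import Relation.Nullary using (¬_)
open import Data.Vec using (Vec; lookup; []; _∷_)
open import Function.Bundles using (_⇔_)

Zmod : ℕ → Set
Zmod n = Fin n

module _ {n : ℕ} .{{_ : NonZero n}} where

  _⊕_ : Zmod n → Zmod n → Zmod n
  a ⊕ b = (toℕ a ℕ.+ toℕ b) mod n

  _⊗_ : Zmod n → Zmod n → Zmod n
  a ⊗ b = (toℕ a ℕ.* toℕ b) mod n

  ⊖_ : Zmod n → Zmod n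
  ⊖ a = (n ℕ.∸ toℕ a) mod n

  one : Zmod n
  one = 1 mod n

  zer : Zmod n
  zer = 0 mod n

  Unit : Zmod n → Set
  Unit u = ∃[ w ] (u ⊗ w ≡ one)

  Vec3 : Set
  Vec3 = Fin 3 → Zmod n

  Mat3 : Set
  Mat3 = Fin 3 → Fin 3 → Zmod n

  vec3 : Zmod n → Zmod n → Zmod n → Vec3
  vec3 a b c i = lookup (a ∷ b ∷ c ∷ []) i

  mat3 : Vec3 → Vec3 → Vec3 → Mat3
  mat3 r0 r1 r2 i = lookup (r0 ∷ r1 ∷ r2 ∷ []) i

  sum3 : (Fin 3 → Zmod n) → Zmod n
  sum3 f = (f (# 0) ⊕ f (# 1)) ⊕ f (# 2)

  _·ᵥ_ : Mat3 → Vec3 → Vec3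
  (A ·ᵥ v) i = sum3 (λ k → A i k ⊗ v k)

  _·ₘ_ : Mat3 → Mat3 → Mat3
  (A ·ₘ B) i j = sum3 (λ k → A i k ⊗ B k j)

  I3 : Mat3
  I3 i j = δ i j
    where
    δ : {m : ℕ} → Fin m → Fin m → Zmod n
    δ zero zero = one
    δ (suc a) (suc b) = δ a b
    δ _ _ = zer

  Invertible : Mat3 → Set
  Invertible A = ∃[ B ] (((i j : Fin 3) → (A ·ₘ B) i j ≡ I3 i j)
                       × ((i j : Fin 3) → (B ·ₘ A) i j ≡ I3 i j))

  -- A and B define the same element of PGL(3, ℤ/nℤ): they differ by a unit scalar
  _≃ₘ_ : Mat3 → Mat3 → Set
  A ≃ₘ B = ∃[ λ' ] (Unit λ' × ((i j : Fin 3) → A i j ≡ B i j ⊗ λ'))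

  -- v generates a free rank-1 submodule: some coordinate is a unit
  IsPoint : Vec3 → Set
  IsPoint v = ∃[ i ] Unit (v i)

  -- v and w generate the same submodule (for unimodular vectors): w = v λ, λ a unit
  _∼_ : Vec3 → Vec3 → Set
  v ∼ w = ∃[ λ' ] (Unit λ' × ((i : Fin 3) → w i ≡ v i ⊗ λ'))

  -- the collineation ⟨v⟩ ↦ ⟨A v⟩ maps the point set {K k} onto itself (setwise)
  Stabilizes : {m : ℕ} → Mat3 → (Fin m → Vec3) → Set
  Stabilizes {m} A K = ((k : Fin m) → ∃[ l ] ((A ·ᵥ K k) ∼ K l))
                     × ((l : Fin m) → ∃[ k ] ((A ·ᵥ K k) ∼ K l))

Z25 : Set
Z25 = Zmod 25

F5 : Set
F5 = Zmod 5

φ : Z25 → F5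
φ a = toℕ a mod 5

φv : Vec3 {25} → Vec3 {5}
φv v i = φ (v i)

kList : Vec (Vec3 {25}) 21
kList =
    vec3 (# 1) (# 1) (# 4)   ∷ vec3 (# 1) (# 19) (# 19) ∷ vec3 (# 1) (# 4) (# 1)
  ∷ vec3 (# 1) (# 1) (# 22)  ∷ vec3 (# 1) (# 8) (# 8)   ∷ vec3 (# 1) (# 22) (# 1)
  ∷ vec3 (# 1) (# 3) (# 12)  ∷ vec3 (# 1) (# 23) (# 19) ∷ vec3 (# 1) (# 4) (# 17)
  ∷ vec3 (# 1) (# 7) (# 8)   ∷ vec3 (# 1) (# 22) (# 4)  ∷ vec3 (# 1) (# 19) (# 18)
  ∷ vec3 (# 1) (# 7) (# 22)  ∷ vec3 (# 1) (# 8) (# 6)   ∷ vec3 (# 1) (# 21) (# 18)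
  ∷ vec3 (# 5) (# 1) (# 2)   ∷ vec3 (# 1) (# 15) (# 13) ∷ vec3 (# 1) (# 2) (# 5)
  ∷ vec3 (# 5) (# 1) (# 23)  ∷ vec3 (# 1) (# 10) (# 12) ∷ vec3 (# 1) (# 23) (# 5)
  ∷ []

𝔨 : Fin 21 → Vec3 {25}
𝔨 i = lookup kList i

M : Mat3 {25}
M = mat3 (vec3 (# 0) (# 1) (# 0)) (vec3 (# 0) (# 0) (# 1)) (vec3 (# 1) (# 0) (# 0))

M² : Mat3 {25}
M² = M ·ₘ M

InImage : Vec3 {5} → Set
InImage P = ∃[ k ] (φv (𝔨 k) ∼ P)

Listed : Vec3 {5} → Set
Listed P = (∃[ a ] (P ∼ vec3 (# 0) (# 1) (⊖ (a ⊗ a))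
                   ⊎ P ∼ vec3 (# 1) (⊖ (a ⊗ a)) (# 0)
                   ⊎ P ∼ vec3 (⊖ (a ⊗ a)) (# 0) (# 1)))
         ⊎ P ∼ vec3 (# 1) (# 1) (# 1)

module Submission where

-- The statements about ρ (invertible, stabilizes 𝔨, of order three), the distinct
-- neighbour classes and the complement of φ(𝔨) in PG(2, 𝔽₅) are finite, and are decided
-- by computation.  The content of the theorem is that every invertible A stabilizing 𝔨
-- is a power of ρ in PGL(3, ℤ₂₅).  So σ sends the frame 𝔨₁₅, 𝔨₁₆, 𝔨₁₇, 𝔨₁₈ into
--     these six points, and for each of the 216 such images the frame matrix either fails
--     to map 𝔨 into itself or is a power of ρ.

open import Defs
open import Data.Nat as ℕ using (ℕ; NonZero; _%_)
open import Data.Nat.Properties as ℕ using ()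
open import Data.Nat.DivMod using (_mod_; %-distribˡ-+; %-distribˡ-*; m%n%n≡m%n; m<n⇒m%n≡m; n%n≡0)
open import Data.Fin using (Fin; toℕ; #_; zero; suc)
open import Data.Fin.Properties using (toℕ-fromℕ<; toℕ-injective; toℕ<n; any?; all?; _≟_)
open import Data.Product using (∃-syntax; _×_; _,_; proj₁; proj₂)
open import Data.Sum using (_⊎_; inj₁; inj₂)
open import Data.Vec using (Vec; lookup; tabulate; _∷_; []; _++_)
open import Data.Vec.Properties using (lookup∘tabulate)
open import Data.Vec.N-ary using (N-ary)
open import Function.Bundles using (_⇔_; mk⇔; Equivalence)
open import Relation.Nullary using (¬_; Dec; yes; no)
open import Relation.Nullary.Decidable using (from-yes; map′; ¬?; _×-dec_; _⊎-dec_; _→-dec_; dec⇒maybe)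
open import Relation.Binary.PropositionalEquality
open import Algebra.Bundles using (CommutativeRing)
open import Algebra.Bundles.Raw using (RawRing)
open import Algebra.Structures using (IsCommutativeRing)
open import Level using (0ℓ)
open import Tactic.RingSolver.Core.AlmostCommutativeRing using (AlmostCommutativeRing; fromCommutativeRing)
import Tactic.RingSolver.NonReflective

-- ℤ/nℤ, with the operations of Defs, is a commutative ring for every n ≠ 0.
-- Every law is transported from ℕ along toℕ, which computes the operations modulo n.
module ZmodRing (n : ℕ) .{{_ : NonZero n}} where

  private
    toℕ-mod : ∀ m → toℕ (m mod n) ≡ m % n
    toℕ-mod m = toℕ-fromℕ< _

    toℕ-⊕ : (a b : Zmod n) → toℕ (a ⊕ b) ≡ (toℕ a ℕ.+ toℕ b) % n
    toℕ-⊕ a b = toℕ-mod (toℕ a ℕ.+ toℕ b)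

    toℕ-⊗ : (a b : Zmod n) → toℕ (a ⊗ b) ≡ (toℕ a ℕ.* toℕ b) % n
    toℕ-⊗ a b = toℕ-mod (toℕ a ℕ.* toℕ b)

    toℕ-reduced : (a : Zmod n) → toℕ a % n ≡ toℕ a
    toℕ-reduced a = m<n⇒m%n≡m (toℕ<n a)

    absorbˡ : (_∙_ : ℕ → ℕ → ℕ) → (∀ x y → (x ∙ y) % n ≡ ((x % n) ∙ (y % n)) % n) →
              ∀ x y → ((x % n) ∙ y) % n ≡ (x ∙ y) % n
    absorbˡ _∙_ distrib x y = begin
      ((x % n) ∙ y) % n           ≡⟨ distrib (x % n) y ⟩
      ((x % n % n) ∙ (y % n)) % n ≡⟨ cong (λ z → (z ∙ (y % n)) % n) (m%n%n≡m%n x n) ⟩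
      ((x % n) ∙ (y % n)) % n     ≡⟨ distrib x y ⟨
      (x ∙ y) % n                 ∎
      where open ≡-Reasoning

    absorbʳ : (_∙_ : ℕ → ℕ → ℕ) → (∀ x y → x ∙ y ≡ y ∙ x) →
              (∀ x y → (x ∙ y) % n ≡ ((x % n) ∙ (y % n)) % n) →
              ∀ x y → (x ∙ (y % n)) % n ≡ (x ∙ y) % n
    absorbʳ _∙_ comm distrib x y = begin
      (x ∙ (y % n)) % n ≡⟨ cong (_% n) (comm x (y % n)) ⟩
      ((y % n) ∙ x) % n ≡⟨ absorbˡ _∙_ distrib y x ⟩
      (y ∙ x) % n       ≡⟨ cong (_% n) (comm y x) ⟩
      (x ∙ y) % n       ∎
      where open ≡-Reasoning

    +-absorbˡ : ∀ x y → ((x % n) ℕ.+ y) % n ≡ (x ℕ.+ y) % n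
    +-absorbˡ = absorbˡ ℕ._+_ (λ x y → %-distribˡ-+ x y n)

    +-absorbʳ : ∀ x y → (x ℕ.+ (y % n)) % n ≡ (x ℕ.+ y) % n
    +-absorbʳ = absorbʳ ℕ._+_ ℕ.+-comm (λ x y → %-distribˡ-+ x y n)

    *-absorbˡ : ∀ x y → ((x % n) ℕ.* y) % n ≡ (x ℕ.* y) % n
    *-absorbˡ = absorbˡ ℕ._*_ (λ x y → %-distribˡ-* x y n)

    *-absorbʳ : ∀ x y → (x ℕ.* (y % n)) % n ≡ (x ℕ.* y) % n
    *-absorbʳ = absorbʳ ℕ._*_ ℕ.*-comm (λ x y → %-distribˡ-* x y n)

  ⊕-assoc : (a b c : Zmod n) → (a ⊕ b) ⊕ c ≡ a ⊕ (b ⊕ c)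
  ⊕-assoc a b c = toℕ-injective (begin
    toℕ ((a ⊕ b) ⊕ c)                 ≡⟨ toℕ-⊕ (a ⊕ b) c ⟩
    (toℕ (a ⊕ b) ℕ.+ toℕ c) % n       ≡⟨ cong (λ z → (z ℕ.+ toℕ c) % n) (toℕ-⊕ a b) ⟩
    ((toℕ a ℕ.+ toℕ b) % n ℕ.+ toℕ c) % n ≡⟨ +-absorbˡ (toℕ a ℕ.+ toℕ b) (toℕ c) ⟩
    (toℕ a ℕ.+ toℕ b ℕ.+ toℕ c) % n   ≡⟨ cong (_% n) (ℕ.+-assoc (toℕ a) (toℕ b) (toℕ c)) ⟩
    (toℕ a ℕ.+ (toℕ b ℕ.+ toℕ c)) % n ≡⟨ +-absorbʳ (toℕ a) (toℕ b ℕ.+ toℕ c) ⟨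
    (toℕ a ℕ.+ ((toℕ b ℕ.+ toℕ c) % n)) % n ≡⟨ cong (λ z → (toℕ a ℕ.+ z) % n) (toℕ-⊕ b c) ⟨
    (toℕ a ℕ.+ toℕ (b ⊕ c)) % n       ≡⟨ toℕ-⊕ a (b ⊕ c) ⟨
    toℕ (a ⊕ (b ⊕ c))                 ∎)
    where open ≡-Reasoning

  ⊗-assoc : (a b c : Zmod n) → (a ⊗ b) ⊗ c ≡ a ⊗ (b ⊗ c)
  ⊗-assoc a b c = toℕ-injective (begin
    toℕ ((a ⊗ b) ⊗ c)                 ≡⟨ toℕ-⊗ (a ⊗ b) c ⟩
    (toℕ (a ⊗ b) ℕ.* toℕ c) % n       ≡⟨ cong (λ z → (z ℕ.* toℕ c) % n) (toℕ-⊗ a b) ⟩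
    ((toℕ a ℕ.* toℕ b) % n ℕ.* toℕ c) % n ≡⟨ *-absorbˡ (toℕ a ℕ.* toℕ b) (toℕ c) ⟩
    (toℕ a ℕ.* toℕ b ℕ.* toℕ c) % n   ≡⟨ cong (_% n) (ℕ.*-assoc (toℕ a) (toℕ b) (toℕ c)) ⟩
    (toℕ a ℕ.* (toℕ b ℕ.* toℕ c)) % n ≡⟨ *-absorbʳ (toℕ a) (toℕ b ℕ.* toℕ c) ⟨
    (toℕ a ℕ.* ((toℕ b ℕ.* toℕ c) % n)) % n ≡⟨ cong (λ z → (toℕ a ℕ.* z) % n) (toℕ-⊗ b c) ⟨
    (toℕ a ℕ.* toℕ (b ⊗ c)) % n       ≡⟨ toℕ-⊗ a (b ⊗ c) ⟨
    toℕ (a ⊗ (b ⊗ c))                 ∎)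
    where open ≡-Reasoning

  ⊕-comm : (a b : Zmod n) → a ⊕ b ≡ b ⊕ a
  ⊕-comm a b = cong (_mod n) (ℕ.+-comm (toℕ a) (toℕ b))

  ⊗-comm : (a b : Zmod n) → a ⊗ b ≡ b ⊗ a
  ⊗-comm a b = cong (_mod n) (ℕ.*-comm (toℕ a) (toℕ b))

  ⊕-identityˡ : (a : Zmod n) → zer ⊕ a ≡ a
  ⊕-identityˡ a = toℕ-injective (begin
    toℕ (zer ⊕ a)                   ≡⟨ toℕ-⊕ zer a ⟩
    (toℕ (0 mod n) ℕ.+ toℕ a) % n   ≡⟨ cong (λ z → (z ℕ.+ toℕ a) % n) (toℕ-mod 0) ⟩
    (0 % n ℕ.+ toℕ a) % n           ≡⟨ +-absorbˡ 0 (toℕ a) ⟩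
    toℕ a % n                       ≡⟨ toℕ-reduced a ⟩
    toℕ a                           ∎)
    where open ≡-Reasoning

  ⊗-identityˡ : (a : Zmod n) → one ⊗ a ≡ a
  ⊗-identityˡ a = toℕ-injective (begin
    toℕ (one ⊗ a)                   ≡⟨ toℕ-⊗ one a ⟩
    (toℕ (1 mod n) ℕ.* toℕ a) % n   ≡⟨ cong (λ z → (z ℕ.* toℕ a) % n) (toℕ-mod 1) ⟩
    (1 % n ℕ.* toℕ a) % n           ≡⟨ *-absorbˡ 1 (toℕ a) ⟩
    (1 ℕ.* toℕ a) % n               ≡⟨ cong (_% n) (ℕ.*-identityˡ (toℕ a)) ⟩
    toℕ a % n                       ≡⟨ toℕ-reduced a ⟩
    toℕ a                           ∎)
    where open ≡-Reasoning

  ⊗-distribˡ-⊕ : (a b c : Zmod n) → a ⊗ (b ⊕ c) ≡ (a ⊗ b) ⊕ (a ⊗ c)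
  ⊗-distribˡ-⊕ a b c = toℕ-injective (begin
    toℕ (a ⊗ (b ⊕ c))                           ≡⟨ toℕ-⊗ a (b ⊕ c) ⟩
    (toℕ a ℕ.* toℕ (b ⊕ c)) % n                 ≡⟨ cong (λ z → (toℕ a ℕ.* z) % n) (toℕ-⊕ b c) ⟩
    (toℕ a ℕ.* ((toℕ b ℕ.+ toℕ c) % n)) % n     ≡⟨ *-absorbʳ (toℕ a) (toℕ b ℕ.+ toℕ c) ⟩
    (toℕ a ℕ.* (toℕ b ℕ.+ toℕ c)) % n           ≡⟨ cong (_% n) (ℕ.*-distribˡ-+ (toℕ a) (toℕ b) (toℕ c)) ⟩
    (x ℕ.+ y) % n                               ≡⟨ +-absorbˡ x y ⟨
    (x % n ℕ.+ y) % n                           ≡⟨ +-absorbʳ (x % n) y ⟨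
    (x % n ℕ.+ y % n) % n                       ≡⟨ cong₂ (λ u v → (u ℕ.+ v) % n) (toℕ-⊗ a b) (toℕ-⊗ a c) ⟨
    (toℕ (a ⊗ b) ℕ.+ toℕ (a ⊗ c)) % n           ≡⟨ toℕ-⊕ (a ⊗ b) (a ⊗ c) ⟨
    toℕ ((a ⊗ b) ⊕ (a ⊗ c))                     ∎)
    where
    open ≡-Reasoning
    x y : ℕ
    x = toℕ a ℕ.* toℕ b
    y = toℕ a ℕ.* toℕ c

  ⊖-inverseʳ : (a : Zmod n) → a ⊕ (⊖ a) ≡ zer
  ⊖-inverseʳ a = toℕ-injective (begin
    toℕ (a ⊕ (⊖ a))                          ≡⟨ toℕ-⊕ a (⊖ a) ⟩
    (toℕ a ℕ.+ toℕ ((n ℕ.∸ toℕ a) mod n)) % n ≡⟨ cong (λ z → (toℕ a ℕ.+ z) % n) (toℕ-mod (n ℕ.∸ toℕ a)) ⟩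
    (toℕ a ℕ.+ (n ℕ.∸ toℕ a) % n) % n        ≡⟨ +-absorbʳ (toℕ a) (n ℕ.∸ toℕ a) ⟩
    (toℕ a ℕ.+ (n ℕ.∸ toℕ a)) % n            ≡⟨ cong (_% n) (ℕ.m+[n∸m]≡n (ℕ.<⇒≤ (toℕ<n a))) ⟩
    n % n                                    ≡⟨ n%n≡0 n ⟩
    0                                        ≡⟨ m<n⇒m%n≡m (ℕ.>-nonZero⁻¹ n) ⟨
    0 % n                                    ≡⟨ toℕ-mod 0 ⟨
    toℕ zer                                  ∎)
    where open ≡-Reasoning

  ⊗-identityʳ : (a : Zmod n) → a ⊗ one ≡ a
  ⊗-identityʳ a = trans (⊗-comm a one) (⊗-identityˡ a)

  isCommutativeRing : IsCommutativeRing _≡_ _⊕_ _⊗_ ⊖_ zer one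
  isCommutativeRing = record
    { isRing = record
      { +-isAbelianGroup = record
        { isGroup = record
          { isMonoid = record
            { isSemigroup = record
              { isMagma = record { isEquivalence = isEquivalence ; ∙-cong = cong₂ _⊕_ }
              ; assoc = ⊕-assoc }
            ; identity = ⊕-identityˡ , λ a → trans (⊕-comm a zer) (⊕-identityˡ a) }
          ; inverse = (λ a → trans (⊕-comm (⊖ a) a) (⊖-inverseʳ a)) , ⊖-inverseʳ
          ; ⁻¹-cong = cong ⊖_ }
        ; comm = ⊕-comm }
      ; *-cong = cong₂ _⊗_
      ; *-assoc = ⊗-assoc
      ; *-identity = ⊗-identityˡ , ⊗-identityʳ
      ; distrib = ⊗-distribˡ-⊕ , λ a b c → trans (⊗-comm (b ⊕ c) a)
                    (trans (⊗-distribˡ-⊕ a b c) (cong₂ _⊕_ (⊗-comm a b) (⊗-comm a c))) }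
    ; *-comm = ⊗-comm }

  commutativeRing : CommutativeRing _ _
  commutativeRing = record { isCommutativeRing = isCommutativeRing }

module Projective {n : ℕ} .{{_ : NonZero n}} where

  open ZmodRing n
  open import Algebra.Properties.CommutativeSemigroup
    (CommutativeRing.*-commutativeSemigroup commutativeRing) using (interchange)

  private variable
    a b a⁻¹ x : Zmod n
    u v w v′ w′ : Vec3 {n}
    A B C : Mat3 {n}

  unit-⊗ : Unit a → Unit b → Unit (a ⊗ b)
  unit-⊗ {a} {b} (a⁻¹ , aa⁻¹) (b⁻¹ , bb⁻¹) = a⁻¹ ⊗ b⁻¹ , (begin
    (a ⊗ b) ⊗ (a⁻¹ ⊗ b⁻¹) ≡⟨ interchange a b a⁻¹ b⁻¹ ⟩
    (a ⊗ a⁻¹) ⊗ (b ⊗ b⁻¹) ≡⟨ cong₂ _⊗_ aa⁻¹ bb⁻¹ ⟩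
    one ⊗ one             ≡⟨ ⊗-identityˡ one ⟩
    one                   ∎)
    where open ≡-Reasoning

  inverse-unit : a ⊗ a⁻¹ ≡ one → Unit a⁻¹
  inverse-unit {a} {a⁻¹} aa⁻¹ = a , trans (⊗-comm a⁻¹ a) aa⁻¹

  cancel : a ⊗ a⁻¹ ≡ one → (x ⊗ a) ⊗ a⁻¹ ≡ x
  cancel {a} {a⁻¹} {x} aa⁻¹ = begin
    (x ⊗ a) ⊗ a⁻¹ ≡⟨ ⊗-assoc x a a⁻¹ ⟩
    x ⊗ (a ⊗ a⁻¹) ≡⟨ cong (x ⊗_) aa⁻¹ ⟩
    x ⊗ one       ≡⟨ ⊗-identityʳ x ⟩
    x             ∎
    where open ≡-Reasoning

  ∼-sym : v ∼ w → w ∼ v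
  ∼-sym {v} {w} (l , (l⁻¹ , ll⁻¹) , w≡vl) = l⁻¹ , inverse-unit {l} ll⁻¹ , λ i → begin
    v i              ≡⟨ cancel {l} {l⁻¹} {v i} ll⁻¹ ⟨
    (v i ⊗ l) ⊗ l⁻¹  ≡⟨ cong (_⊗ l⁻¹) (w≡vl i) ⟨
    w i ⊗ l⁻¹        ∎
    where open ≡-Reasoning

  ∼-trans : u ∼ v → v ∼ w → u ∼ w
  ∼-trans {u} {v} {w} (l , unit-l , v≡ul) (m , unit-m , w≡vm) =
    l ⊗ m , unit-⊗ {l} {m} unit-l unit-m , λ i → begin
    w i             ≡⟨ w≡vm i ⟩
    v i ⊗ m         ≡⟨ cong (_⊗ m) (v≡ul i) ⟩
    (u i ⊗ l) ⊗ m   ≡⟨ ⊗-assoc (u i) l m ⟩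
    u i ⊗ (l ⊗ m)   ∎
    where open ≡-Reasoning

  ∼-respˡ : v ≗ v′ → v ∼ w → v′ ∼ w
  ∼-respˡ v≗v′ (l , unit-l , w≡vl) = l , unit-l , λ i → trans (w≡vl i) (cong (_⊗ l) (v≗v′ i))

  ∼-respʳ : w ≗ w′ → v ∼ w → v ∼ w′
  ∼-respʳ w≗w′ (l , unit-l , w≡vl) = l , unit-l , λ i → trans (sym (w≗w′ i)) (w≡vl i)

  ≃ₘ-trans : A ≃ₘ B → B ≃ₘ C → A ≃ₘ C
  ≃ₘ-trans {A} {B} {C} (l , unit-l , A≡Bl) (m , unit-m , B≡Cm) =
    m ⊗ l , unit-⊗ {m} {l} unit-m unit-l , λ i j → begin
    A i j           ≡⟨ A≡Bl i j ⟩
    B i j ⊗ l       ≡⟨ cong (_⊗ l) (B≡Cm i j) ⟩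
    (C i j ⊗ m) ⊗ l ≡⟨ ⊗-assoc (C i j) m l ⟩
    C i j ⊗ (m ⊗ l) ∎
    where open ≡-Reasoning

  unit-factor : Unit (a ⊗ b) → Unit a
  unit-factor {a} {b} (w , ab·w≡1) = b ⊗ w , trans (sym (⊗-assoc a b w)) ab·w≡1

  module Decide (inverse : Zmod n → Zmod n)
                (inverse-correct : ∀ a w → a ⊗ w ≡ one → a ⊗ inverse a ≡ one) where

    Unit? : (a : Zmod n) → Dec (Unit a)
    Unit? a = map′ (λ aa⁻¹ → inverse a , aa⁻¹) (λ (w , aw≡1) → inverse-correct a w aw≡1)
                   (a ⊗ inverse a ≟ one)

    IsPoint? : (v : Vec3 {n}) → Dec (IsPoint v)
    IsPoint? v = any? λ i → Unit? (v i)

    private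
      -- if w i is a unit, the only scalar that can relate v to w is (v i)⁻¹ (w i)
      through-unit : (v w : Vec3 {n}) (i : Fin 3) → Unit (w i) → Dec (v ∼ w)
      through-unit v w i unit-wᵢ = map′ sound complete (Unit? (v i) ×-dec all? λ k → w k ≟ v k ⊗ l)
        where
        l : Zmod n
        l = inverse (v i) ⊗ w i

        sound : Unit (v i) × (∀ k → w k ≡ v k ⊗ l) → v ∼ w
        sound ((y , vᵢy≡1) , w≡vl) =
          l , unit-⊗ {a = inverse (v i)} (inverse-unit {a = v i} (inverse-correct (v i) y vᵢy≡1)) unit-wᵢ , w≡vl

        complete : v ∼ w → Unit (v i) × (∀ k → w k ≡ v k ⊗ l)
        complete (μ , _ , w≡vμ) = unit-vᵢ , λ k → trans (w≡vμ k) (cong (v k ⊗_) μ≡l)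
          where
          unit-vᵢ : Unit (v i)
          unit-vᵢ = unit-factor {a = v i} {b = μ} (subst Unit (w≡vμ i) unit-wᵢ)
          vᵢ⁻¹vᵢ≡1 : inverse (v i) ⊗ v i ≡ one
          vᵢ⁻¹vᵢ≡1 = trans (⊗-comm (inverse (v i)) (v i)) (inverse-correct (v i) (proj₁ unit-vᵢ) (proj₂ unit-vᵢ))
          μ≡l : μ ≡ l
          μ≡l = begin
            μ                            ≡⟨ ⊗-identityˡ μ ⟨
            one ⊗ μ                      ≡⟨ cong (_⊗ μ) vᵢ⁻¹vᵢ≡1 ⟨
            (inverse (v i) ⊗ v i) ⊗ μ    ≡⟨ ⊗-assoc (inverse (v i)) (v i) μ ⟩
            inverse (v i) ⊗ (v i ⊗ μ)    ≡⟨ cong (inverse (v i) ⊗_) (w≡vμ i) ⟨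
            l                            ∎
            where open ≡-Reasoning

      search : (v w : Vec3 {n}) → Dec (v ∼ w)
      search v w = any? λ l → map′ (λ (w≡vl , unit-l) → unit-l , w≡vl) (λ (unit-l , w≡vl) → w≡vl , unit-l)
                                   (all? (λ k → w k ≟ v k ⊗ l) ×-dec Unit? l)

    _∼?_ : (v w : Vec3 {n}) → Dec (v ∼ w)
    v ∼? w = through (IsPoint? w)
      where
      through : Dec (IsPoint w) → Dec (v ∼ w)
      through (yes (i , unit-wᵢ)) = through-unit v w i unit-wᵢ
      through (no _)              = search v w

    _≃ₘ?_ : (A B : Mat3 {n}) → Dec (A ≃ₘ B)
    A ≃ₘ? B = any? λ l → map′ (λ (A≡Bl , unit-l) → unit-l , A≡Bl) (λ (unit-l , A≡Bl) → A≡Bl , unit-l)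
                              (all? (λ i → all? λ j → A i j ≟ B i j ⊗ l) ×-dec Unit? l)

-- These definitions are
-- instantiated both at ℤ₂₅ and at ring-solver expressions over ℤ₂₅, so that an
-- identity between them is proved by normalising the expression instance.
module LinearAlgebra {c ℓ} (R : RawRing c ℓ) where
  open RawRing R

  vec : Carrier → Carrier → Carrier → Fin 3 → Carrier
  vec a b c zero             = a
  vec a b c (suc zero)       = b
  vec a b c (suc (suc zero)) = c

  mat : (a b c d e f g h k : Carrier) → Fin 3 → Fin 3 → Carrier
  mat a b c d e f g h k i j = vec (vec a b c j) (vec d e f j) (vec g h k j) i

  cols : (u v w : Fin 3 → Carrier) → Fin 3 → Fin 3 → Carrier
  cols u v w i j = vec (u i) (v i) (w i) j

  col : (Fin 3 → Fin 3 → Carrier) → Fin 3 → Fin 3 → Carrier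
  col Q m i = Q i m

  I : Fin 3 → Fin 3 → Carrier
  I = cols (vec 1# 0# 0#) (vec 0# 1# 0#) (vec 0# 0# 1#)

  replace : (Fin 3 → Fin 3 → Carrier) → Fin 3 → (Fin 3 → Carrier) → Fin 3 → Fin 3 → Carrier
  replace Q zero             b = cols b (col Q (# 1)) (col Q (# 2))
  replace Q (suc zero)       b = cols (col Q (# 0)) b (col Q (# 2))
  replace Q (suc (suc zero)) b = cols (col Q (# 0)) (col Q (# 1)) b

  _⊛_ : (Fin 3 → Carrier) → Carrier → Fin 3 → Carrier
  (v ⊛ a) i = v i * a

  sum : (Fin 3 → Carrier) → Carrier
  sum f = (f (# 0) + f (# 1)) + f (# 2)

  _·_ : (Fin 3 → Fin 3 → Carrier) → (Fin 3 → Carrier) → Fin 3 → Carrier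
  (A · v) i = sum λ k → A i k * v k

  det : (u v w : Fin 3 → Carrier) → Carrier
  det u v w = (u (# 0) * (v (# 1) * w (# 2) + - (v (# 2) * w (# 1)))
              + - (u (# 1) * (v (# 0) * w (# 2) + - (v (# 2) * w (# 0)))))
              + u (# 2) * (v (# 0) * w (# 1) + - (v (# 1) * w (# 0)))

  detₘ : (Fin 3 → Fin 3 → Carrier) → Carrier
  detₘ Q = det (col Q (# 0)) (col Q (# 1)) (col Q (# 2))

-- The ring solver over ℤ₂₅.  Its coefficients are compared with zero by decidable
-- equality, so it decides polynomial identities; those below hold in every commutative ring.
ℤ₂₅-ring : AlmostCommutativeRing 0ℓ 0ℓ
ℤ₂₅-ring = fromCommutativeRing (ZmodRing.commutativeRing 25) (λ x → dec⇒maybe (zer ≟ x))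

module Solver = Tactic.RingSolver.NonReflective ℤ₂₅-ring

open Solver using (Expr; Κ; _⊜_) renaming (_⊕_ to _:+_; _⊗_ to _:*_)

ℤ₂₅-raw : RawRing 0ℓ 0ℓ
ℤ₂₅-raw = record { Carrier = Z25 ; _≈_ = _≡_ ; _+_ = _⊕_ ; _*_ = _⊗_ ; -_ = ⊖_ ; 0# = zer ; 1# = one }

expressions : ℕ → RawRing 0ℓ 0ℓ
expressions k = record
  { Carrier = Expr Z25 k ; _≈_ = _≡_ ; _+_ = Solver._⊕_ ; _*_ = Solver._⊗_ ; -_ = Solver.⊝_
  ; 0# = Κ zer ; 1# = Κ one }

open LinearAlgebra ℤ₂₅-raw using (vec; cols; col; replace; _⊛_; det; detₘ)
module E {k : ℕ} = LinearAlgebra (expressions k)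

-- An identity between expressions, given as a function f of its k variables,
-- holds at the values ρ once both sides have the same normal form.
byRing : ∀ {k} (ρ : Vec Z25 k) (f : N-ary k (Expr Z25 k) (Expr Z25 k × Expr Z25 k)) →
         let (lhs , rhs) = Solver.Ops.close k f in
         Solver.Ops.⟦ lhs ⇓⟧ ρ ≡ Solver.Ops.⟦ rhs ⇓⟧ ρ → Solver.Ops.⟦ lhs ⟧ ρ ≡ Solver.Ops.⟦ rhs ⟧ ρ
byRing {k} ρ f = Solver.Ops.prove ρ (proj₁ (Solver.Ops.close k f)) (proj₂ (Solver.Ops.close k f))

coordinates : Vec3 {25} → Vec Z25 3
coordinates v = v (# 0) ∷ v (# 1) ∷ v (# 2) ∷ []

entries : Mat3 {25} → Vec Z25 9
entries A = coordinates (A (# 0)) ++ coordinates (A (# 1)) ++ coordinates (A (# 2))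

det-mul : (A : Mat3 {25}) (u v w : Vec3 {25}) → det (A ·ᵥ u) (A ·ᵥ v) (A ·ᵥ w) ≡ detₘ A ⊗ det u v w
det-mul A u v w = byRing (entries A ++ coordinates u ++ coordinates v ++ coordinates w)
  (λ a b c d e f g h k u₀ u₁ u₂ v₀ v₁ v₂ w₀ w₁ w₂ →
     let A′ = E.mat a b c d e f g h k ; u′ = E.vec u₀ u₁ u₂ ; v′ = E.vec v₀ v₁ v₂ ; w′ = E.vec w₀ w₁ w₂ in
     E.det (A′ E.· u′) (A′ E.· v′) (A′ E.· w′) ⊜ E.detₘ A′ :* E.det u′ v′ w′) refl

det-scale : (u v w : Vec3 {25}) (a b c : Z25) → det (u ⊛ a) (v ⊛ b) (w ⊛ c) ≡ ((a ⊗ b) ⊗ c) ⊗ det u v w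
det-scale u v w a b c = byRing (coordinates u ++ coordinates v ++ coordinates w ++ a ∷ b ∷ c ∷ [])
  (λ u₀ u₁ u₂ v₀ v₁ v₂ w₀ w₁ w₂ a b c →
     let u′ = E.vec u₀ u₁ u₂ ; v′ = E.vec v₀ v₁ v₂ ; w′ = E.vec w₀ w₁ w₂ in
     E.det (u′ E.⊛ a) (v′ E.⊛ b) (w′ E.⊛ c) ⊜ ((a :* b) :* c) :* E.det u′ v′ w′) refl

cramer : (Q : Mat3 {25}) (x : Vec3 {25}) (m : Fin 3) → detₘ Q ⊗ x m ≡ detₘ (replace Q m (Q ·ᵥ x))
cramer Q x m = case m
  where
  equation : (m : Fin 3) → N-ary 12 (Expr Z25 12) (Expr Z25 12 × Expr Z25 12)
  equation m a b c d e f g h k x₀ x₁ x₂ =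
    let Q′ = E.mat a b c d e f g h k ; x′ = E.vec x₀ x₁ x₂ in
    E.detₘ Q′ :* x′ m ⊜ E.detₘ (E.replace Q′ m (Q′ E.· x′))
  case : (m : Fin 3) → detₘ Q ⊗ x m ≡ detₘ (replace Q m (Q ·ᵥ x))
  case zero             = byRing (entries Q ++ coordinates x) (equation zero) refl
  case (suc zero)       = byRing (entries Q ++ coordinates x) (equation (suc zero)) refl
  case (suc (suc zero)) = byRing (entries Q ++ coordinates x) (equation (suc (suc zero))) refl

replace-scale : (Q : Mat3 {25}) (m : Fin 3) (b : Vec3 {25}) (a : Z25) →
                detₘ (replace Q m (b ⊛ a)) ≡ a ⊗ detₘ (replace Q m b)
replace-scale Q m b a = case m
  where
  equation : (m : Fin 3) → N-ary 13 (Expr Z25 13) (Expr Z25 13 × Expr Z25 13)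
  equation m q₀₀ q₀₁ q₀₂ q₁₀ q₁₁ q₁₂ q₂₀ q₂₁ q₂₂ b₀ b₁ b₂ a =
    let Q′ = E.mat q₀₀ q₀₁ q₀₂ q₁₀ q₁₁ q₁₂ q₂₀ q₂₁ q₂₂ ; b′ = E.vec b₀ b₁ b₂ in
    E.detₘ (E.replace Q′ m (b′ E.⊛ a)) ⊜ a :* E.detₘ (E.replace Q′ m b′)
  case : (m : Fin 3) → detₘ (replace Q m (b ⊛ a)) ≡ a ⊗ detₘ (replace Q m b)
  case zero             = byRing (entries Q ++ coordinates b ++ a ∷ []) (equation zero) refl
  case (suc zero)       = byRing (entries Q ++ coordinates b ++ a ∷ []) (equation (suc zero)) refl
  case (suc (suc zero)) = byRing (entries Q ++ coordinates b ++ a ∷ []) (equation (suc (suc zero))) refl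

row-mat-col : (a : Vec3 {25}) (P : Mat3 {25}) (w : Vec3 {25}) →
              sum3 (λ k → a k ⊗ sum3 (λ m → P k m ⊗ w m)) ≡ sum3 (λ m → sum3 (λ k → a k ⊗ P k m) ⊗ w m)
row-mat-col a P w = byRing (coordinates a ++ entries P ++ coordinates w)
  (λ a₀ a₁ a₂ p₀₀ p₀₁ p₀₂ p₁₀ p₁₁ p₁₂ p₂₀ p₂₁ p₂₂ w₀ w₁ w₂ →
     let a′ = E.vec a₀ a₁ a₂ ; P′ = E.mat p₀₀ p₀₁ p₀₂ p₁₀ p₁₁ p₁₂ p₂₀ p₂₁ p₂₂ ; w′ = E.vec w₀ w₁ w₂ in
     E.sum (λ k → a′ k :* E.sum (λ m → P′ k m :* w′ m)) ⊜ E.sum (λ m → E.sum (λ k → a′ k :* P′ k m) :* w′ m)) refl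

·ₘ-identityʳ : (A : Mat3 {25}) → ∀ i j → (A ·ₘ I3) i j ≡ A i j
·ₘ-identityʳ A i j = case j
  where
  equation : (j : Fin 3) → N-ary 3 (Expr Z25 3) (Expr Z25 3 × Expr Z25 3)
  equation j a₀ a₁ a₂ = let a′ = E.vec a₀ a₁ a₂ in E.sum (λ k → a′ k :* E.I k j) ⊜ a′ j
  case : (j : Fin 3) → (A ·ₘ I3) i j ≡ A i j
  case zero             = byRing (coordinates (A i)) (equation zero) refl
  case (suc zero)       = byRing (coordinates (A i)) (equation (suc zero)) refl
  case (suc (suc zero)) = byRing (coordinates (A i)) (equation (suc (suc zero))) refl

row-scale : (b v : Vec3 {25}) (l : Z25) → sum3 (λ k → (b k ⊗ l) ⊗ v k) ≡ sum3 (λ k → b k ⊗ v k) ⊗ l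
row-scale b v l = byRing (coordinates b ++ coordinates v ++ l ∷ [])
  (λ b₀ b₁ b₂ v₀ v₁ v₂ l → let b′ = E.vec b₀ b₁ b₂ ; v′ = E.vec v₀ v₁ v₂ in
     E.sum (λ k → (b′ k :* l) :* v′ k) ⊜ E.sum (λ k → b′ k :* v′ k) :* l) refl

scalar-into-sum : (d : Z25) (q n w : Vec3 {25}) →
                  d ⊗ sum3 (λ m → (q m ⊗ n m) ⊗ w m) ≡ sum3 (λ m → q m ⊗ ((d ⊗ n m) ⊗ w m))
scalar-into-sum d q n w = byRing (d ∷ coordinates q ++ coordinates n ++ coordinates w)
  (λ d q₀ q₁ q₂ n₀ n₁ n₂ w₀ w₁ w₂ → let q′ = E.vec q₀ q₁ q₂ ; n′ = E.vec n₀ n₁ n₂ ; w′ = E.vec w₀ w₁ w₂ in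
     d :* E.sum (λ m → (q′ m :* n′ m) :* w′ m) ⊜ E.sum (λ m → q′ m :* ((d :* n′ m) :* w′ m))) refl

scalar-out-of-sum : (a : Z25) (q x w : Vec3 {25}) →
                    sum3 (λ m → q m ⊗ ((a ⊗ x m) ⊗ w m)) ≡ a ⊗ sum3 (λ m → q m ⊗ (x m ⊗ w m))
scalar-out-of-sum a q x w = byRing (a ∷ coordinates q ++ coordinates x ++ coordinates w)
  (λ a q₀ q₁ q₂ x₀ x₁ x₂ w₀ w₁ w₂ → let q′ = E.vec q₀ q₁ q₂ ; x′ = E.vec x₀ x₁ x₂ ; w′ = E.vec w₀ w₁ w₂ in
     E.sum (λ m → q′ m :* ((a :* x′ m) :* w′ m)) ⊜ a :* E.sum (λ m → q′ m :* (x′ m :* w′ m))) refl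

sum3-cong : {f g : Fin 3 → Z25} → f ≗ g → sum3 f ≡ sum3 g
sum3-cong f≗g = cong₂ _⊕_ (cong₂ _⊕_ (f≗g (# 0)) (f≗g (# 1))) (f≗g (# 2))

·ᵥ-congʳ : (A : Mat3 {25}) {v v′ : Vec3 {25}} → v ≗ v′ → A ·ᵥ v ≗ A ·ᵥ v′
·ᵥ-congʳ A v≗v′ i = sum3-cong λ k → cong (A i k ⊗_) (v≗v′ k)

-- det u v w is definitionally a function of the coordinates of u, v and w
det-cong : {u u′ v v′ w w′ : Vec3 {25}} → u ≗ u′ → v ≗ v′ → w ≗ w′ → det u v w ≡ det u′ v′ w′
det-cong {u} {u′} {v} {v′} {w} {w′} u≗u′ v≗v′ w≗w′ = begin
  det u v w    ≡⟨ cong (λ x → det (lookup x) v w) (coordinates-cong u≗u′) ⟩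
  det u′ v w   ≡⟨ cong (λ x → det u′ (lookup x) w) (coordinates-cong v≗v′) ⟩
  det u′ v′ w  ≡⟨ cong (λ x → det u′ v′ (lookup x)) (coordinates-cong w≗w′) ⟩
  det u′ v′ w′ ∎
  where
  open ≡-Reasoning
  coordinates-cong : {x x′ : Vec3 {25}} → x ≗ x′ → coordinates x ≡ coordinates x′
  coordinates-cong x≗x′ = cong₂ _∷_ (x≗x′ (# 0)) (cong₂ _∷_ (x≗x′ (# 1)) (cong₂ _∷_ (x≗x′ (# 2)) refl))

replace-cong : (Q : Mat3 {25}) (m : Fin 3) {b b′ : Vec3 {25}} → b ≗ b′ →
               detₘ (replace Q m b) ≡ detₘ (replace Q m b′)
replace-cong Q zero {b} {b′} b≗b′ =
  det-cong {b} {b′} {col Q (# 1)} {col Q (# 1)} {col Q (# 2)} {col Q (# 2)} b≗b′ (λ _ → refl) (λ _ → refl)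
replace-cong Q (suc zero) {b} {b′} b≗b′ =
  det-cong {col Q (# 0)} {col Q (# 0)} {b} {b′} {col Q (# 2)} {col Q (# 2)} (λ _ → refl) b≗b′ (λ _ → refl)
replace-cong Q (suc (suc zero)) {b} {b′} b≗b′ =
  det-cong {col Q (# 0)} {col Q (# 0)} {col Q (# 1)} {col Q (# 1)} {b} {b′} (λ _ → refl) (λ _ → refl) b≗b′

open ZmodRing 25 using (⊗-assoc; ⊗-comm)
open import Algebra.Properties.CommutativeSemigroup
  (CommutativeRing.*-commutativeSemigroup (ZmodRing.commutativeRing 25)) using (xy∙z≈x∙zy; xy∙z≈y∙xz)
open Projective using (unit-⊗; inverse-unit; cancel; ∼-sym; ∼-trans; ∼-respˡ; ∼-respʳ; ≃ₘ-trans)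

-- A matrix is determined, up to a scalar factor,
-- by the points to which it maps the frame.
module Frame (p₀ p₁ p₂ p₃ : Vec3 {25}) (W : Mat3 {25}) (c c⁻¹ : Vec3 {25})
             (P·W≡I : ∀ i j → (cols p₀ p₁ p₂ ·ₘ W) i j ≡ I3 i j)
             (p₃≡P·c : p₃ ≗ cols p₀ p₁ p₂ ·ᵥ c)
             (c·c⁻¹≡1 : ∀ m → c m ⊗ c⁻¹ m ≡ one) where

  P : Mat3 {25}
  P = cols p₀ p₁ p₂

  -- the scalars given by Cramer's rule for q₃ in the basis of the columns of Q
  cramerCoefficient : Mat3 {25} → Vec3 {25} → Vec3 {25}
  cramerCoefficient Q q₃ m = c⁻¹ m ⊗ detₘ (replace Q m q₃)

  -- The matrix mapping the frame to the columns of Q and to q₃, up to scalars.  It is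
  -- opaque, so that the matrices built from it are compared by name rather than by value.
  opaque
    frameMatrix : Mat3 {25} → Vec3 {25} → Mat3 {25}
    frameMatrix Q q₃ i j = sum3 λ m → Q i m ⊗ (cramerCoefficient Q q₃ m ⊗ W m j)

    frameMatrix-entry : (Q : Mat3 {25}) (q₃ : Vec3 {25}) →
                        ∀ i j → frameMatrix Q q₃ i j ≡ sum3 (λ m → Q i m ⊗ (cramerCoefficient Q q₃ m ⊗ W m j))
    frameMatrix-entry Q q₃ i j = refl

  module _ (A Q : Mat3 {25}) (q₃ n : Vec3 {25}) (n₃ : Z25)
           (image : ∀ m i → (A ·ᵥ col P m) i ≡ Q i m ⊗ n m)
           (image₃ : ∀ i → (A ·ᵥ p₃) i ≡ q₃ i ⊗ n₃) where

    -- A = A P W = Q diag(n) W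
    expansion : ∀ i j → A i j ≡ sum3 (λ m → (Q i m ⊗ n m) ⊗ W m j)
    expansion i j = begin
      A i j                                  ≡⟨ ·ₘ-identityʳ A i j ⟨
      (A ·ₘ I3) i j                          ≡⟨ sum3-cong (λ k → cong (A i k ⊗_) (P·W≡I k j)) ⟨
      sum3 (λ k → A i k ⊗ (P ·ₘ W) k j)      ≡⟨ row-mat-col (A i) P (λ m → W m j) ⟩
      sum3 (λ m → (A ·ᵥ col P m) i ⊗ W m j)  ≡⟨ sum3-cong (λ m → cong (_⊗ W m j) (image m i)) ⟩
      sum3 (λ m → (Q i m ⊗ n m) ⊗ W m j)     ∎
      where open ≡-Reasoning

    -- q₃ n₃ = A P c = Q (n c)
    fourth-image : ∀ i → q₃ i ⊗ n₃ ≡ (Q ·ᵥ (λ m → n m ⊗ c m)) i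
    fourth-image i = begin
      q₃ i ⊗ n₃                             ≡⟨ image₃ i ⟨
      (A ·ᵥ p₃) i                           ≡⟨ ·ᵥ-congʳ A p₃≡P·c i ⟩
      (A ·ᵥ (P ·ᵥ c)) i                     ≡⟨ row-mat-col (A i) P c ⟩
      sum3 (λ m → (A ·ᵥ col P m) i ⊗ c m)   ≡⟨ sum3-cong (λ m → cong (_⊗ c m) (image m i)) ⟩
      sum3 (λ m → (Q i m ⊗ n m) ⊗ c m)      ≡⟨ sum3-cong (λ m → ⊗-assoc (Q i m) (n m) (c m)) ⟩
      (Q ·ᵥ (λ m → n m ⊗ c m)) i            ∎
      where open ≡-Reasoning

    -- by Cramer's rule, det Q · n is proportional to the Cramer coefficients
    scalars : ∀ m → detₘ Q ⊗ n m ≡ n₃ ⊗ cramerCoefficient Q q₃ m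
    scalars m = begin
      detₘ Q ⊗ n m                                          ≡⟨ cancel {a = c m} {a⁻¹ = c⁻¹ m} (c·c⁻¹≡1 m) ⟨
      ((detₘ Q ⊗ n m) ⊗ c m) ⊗ c⁻¹ m                        ≡⟨ cong (_⊗ c⁻¹ m) (⊗-assoc (detₘ Q) (n m) (c m)) ⟩
      (detₘ Q ⊗ (n m ⊗ c m)) ⊗ c⁻¹ m                        ≡⟨ cong (_⊗ c⁻¹ m) (cramer Q (λ m → n m ⊗ c m) m) ⟩
      detₘ (replace Q m (Q ·ᵥ (λ m → n m ⊗ c m))) ⊗ c⁻¹ m   ≡⟨ cong (_⊗ c⁻¹ m) (replace-cong Q m fourth-image) ⟨
      detₘ (replace Q m (q₃ ⊛ n₃)) ⊗ c⁻¹ m                  ≡⟨ cong (_⊗ c⁻¹ m) (replace-scale Q m q₃ n₃) ⟩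
      (n₃ ⊗ detₘ (replace Q m q₃)) ⊗ c⁻¹ m                  ≡⟨ xy∙z≈x∙zy n₃ (detₘ (replace Q m q₃)) (c⁻¹ m) ⟩
      n₃ ⊗ cramerCoefficient Q q₃ m                         ∎
      where open ≡-Reasoning

    frame-lemma : ∀ i j → detₘ Q ⊗ A i j ≡ n₃ ⊗ frameMatrix Q q₃ i j
    frame-lemma i j = begin
      detₘ Q ⊗ A i j                                                  ≡⟨ cong (detₘ Q ⊗_) (expansion i j) ⟩
      detₘ Q ⊗ sum3 (λ m → (Q i m ⊗ n m) ⊗ W m j)                     ≡⟨ scalar-into-sum (detₘ Q) (Q i) n (λ m → W m j) ⟩
      sum3 (λ m → Q i m ⊗ ((detₘ Q ⊗ n m) ⊗ W m j))                   ≡⟨ sum3-cong (λ m → cong (λ x → Q i m ⊗ (x ⊗ W m j)) (scalars m)) ⟩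
      sum3 (λ m → Q i m ⊗ ((n₃ ⊗ cramerCoefficient Q q₃ m) ⊗ W m j))   ≡⟨ scalar-out-of-sum n₃ (Q i) (cramerCoefficient Q q₃) (λ m → W m j) ⟩
      n₃ ⊗ sum3 (λ m → Q i m ⊗ (cramerCoefficient Q q₃ m ⊗ W m j))     ≡⟨ cong (n₃ ⊗_) (frameMatrix-entry Q q₃ i j) ⟨
      n₃ ⊗ frameMatrix Q q₃ i j                                       ∎
      where open ≡-Reasoning

  frame-determines : (A : Mat3 {25}) (q₀ q₁ q₂ q₃ : Vec3 {25}) →
                     q₀ ∼ (A ·ᵥ p₀) → q₁ ∼ (A ·ᵥ p₁) → q₂ ∼ (A ·ᵥ p₂) → q₃ ∼ (A ·ᵥ p₃) →
                     Unit (det q₀ q₁ q₂) → A ≃ₘ frameMatrix (cols q₀ q₁ q₂) q₃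
  frame-determines A q₀ q₁ q₂ q₃ image₀ image₁ image₂ (n₃ , unit-n₃ , image₃) (d⁻¹ , dd⁻¹) =
    n₃ ⊗ d⁻¹ , unit-⊗ {a = n₃} {b = d⁻¹} unit-n₃ (inverse-unit {a = d} dd⁻¹) , λ i j → begin
      A i j                ≡⟨ cancel {a = d} {a⁻¹ = d⁻¹} dd⁻¹ ⟨
      (A i j ⊗ d) ⊗ d⁻¹    ≡⟨ cong (_⊗ d⁻¹) (⊗-comm (A i j) d) ⟩
      (d ⊗ A i j) ⊗ d⁻¹    ≡⟨ cong (_⊗ d⁻¹) (frame-lemma A Q q₃ n n₃ image image₃ i j) ⟩
      (n₃ ⊗ F i j) ⊗ d⁻¹   ≡⟨ xy∙z≈y∙xz n₃ (F i j) d⁻¹ ⟩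
      F i j ⊗ (n₃ ⊗ d⁻¹)   ∎
    where
    open ≡-Reasoning
    Q : Mat3 {25}
    Q = cols q₀ q₁ q₂
    d : Z25
    d = det q₀ q₁ q₂
    F : Mat3 {25}
    F = frameMatrix Q q₃
    images : ∀ m → col Q m ∼ (A ·ᵥ col P m)
    images zero             = image₀
    images (suc zero)       = image₁
    images (suc (suc zero)) = image₂
    n : Vec3 {25}
    n m = proj₁ (images m)
    image : ∀ m i → (A ·ᵥ col P m) i ≡ Q i m ⊗ n m
    image m = proj₂ (proj₂ (images m))

-- an invertible matrix has a unit determinant, since det (B A) = det B det A
invertible-det : (A : Mat3 {25}) → Invertible A → Unit (detₘ A)
invertible-det A (B , _ , B·A≡I) = detₘ B , (begin
  detₘ A ⊗ detₘ B   ≡⟨ ⊗-comm (detₘ A) (detₘ B) ⟩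
  detₘ B ⊗ detₘ A   ≡⟨ det-mul B (col A (# 0)) (col A (# 1)) (col A (# 2)) ⟨
  detₘ (B ·ₘ A)     ≡⟨ det-cong (λ i → B·A≡I i (# 0)) (λ i → B·A≡I i (# 1)) (λ i → B·A≡I i (# 2)) ⟩
  detₘ I3           ≡⟨⟩
  one               ∎)
  where open ≡-Reasoning

unit-triangle-image : (A : Mat3 {25}) (u v w u′ v′ w′ : Vec3 {25}) → Unit (detₘ A) →
                      (A ·ᵥ u) ∼ u′ → (A ·ᵥ v) ∼ v′ → (A ·ᵥ w) ∼ w′ →
                      Unit (det u v w) → Unit (det u′ v′ w′)
unit-triangle-image A u v w u′ v′ w′ unit-A (a , unit-a , u′≡ua) (b , unit-b , v′≡vb) (c , unit-c , w′≡wc) unit-uvw =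
  subst Unit (sym image-det)
    (unit-⊗ {a = (a ⊗ b) ⊗ c} (unit-⊗ {a = a ⊗ b} (unit-⊗ {a = a} unit-a unit-b) unit-c)
                              (unit-⊗ {a = detₘ A} unit-A unit-uvw))
  where
  image-det : det u′ v′ w′ ≡ ((a ⊗ b) ⊗ c) ⊗ (detₘ A ⊗ det u v w)
  image-det = begin
    det u′ v′ w′                                     ≡⟨ det-cong u′≡ua v′≡vb w′≡wc ⟩
    det ((A ·ᵥ u) ⊛ a) ((A ·ᵥ v) ⊛ b) ((A ·ᵥ w) ⊛ c) ≡⟨ det-scale (A ·ᵥ u) (A ·ᵥ v) (A ·ᵥ w) a b c ⟩
    ((a ⊗ b) ⊗ c) ⊗ det (A ·ᵥ u) (A ·ᵥ v) (A ·ᵥ w)   ≡⟨ cong (((a ⊗ b) ⊗ c) ⊗_) (det-mul A u v w) ⟩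
    ((a ⊗ b) ⊗ c) ⊗ (detₘ A ⊗ det u v w)             ∎
    where open ≡-Reasoning

≃ₘ-images : {A F : Mat3 {25}} → A ≃ₘ F → (v : Vec3 {25}) → (F ·ᵥ v) ∼ (A ·ᵥ v)
≃ₘ-images {A} {F} (l , unit-l , A≡Fl) v = l , unit-l , λ i → begin
  (A ·ᵥ v) i                        ≡⟨ sum3-cong (λ k → cong (_⊗ v k) (A≡Fl i k)) ⟩
  sum3 (λ k → (F i k ⊗ l) ⊗ v k)    ≡⟨ row-scale (F i) v l ⟩
  (F ·ᵥ v) i ⊗ l                    ∎
  where open ≡-Reasoning

-- Inverses in ℤ₂₅ and 𝔽₅, by table; units are then decided with a single product.
inverse₂₅ : Z25 → Z25
inverse₂₅ a = lookup (# 0 ∷ # 1 ∷ # 13 ∷ # 17 ∷ # 19 ∷ # 0 ∷ # 21 ∷ # 18 ∷ # 22 ∷ # 14 ∷ # 0 ∷ # 16 ∷ # 23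
                      ∷ # 2 ∷ # 9 ∷ # 0 ∷ # 11 ∷ # 3 ∷ # 7 ∷ # 4 ∷ # 0 ∷ # 6 ∷ # 8 ∷ # 12 ∷ # 24 ∷ []) a

inverse₅ : F5 → F5
inverse₅ a = lookup (# 0 ∷ # 1 ∷ # 3 ∷ # 2 ∷ # 4 ∷ []) a

-- The facts below are finite computations, checked by evaluating decision procedures.
-- They are opaque: they are used only through their statements.
opaque
  inverse₂₅-correct : ∀ a w → a ⊗ w ≡ one → a ⊗ inverse₂₅ a ≡ one
  inverse₂₅-correct = from-yes (all? λ a → all? λ w → (a ⊗ w ≟ one) →-dec (a ⊗ inverse₂₅ a ≟ one))

  inverse₅-correct : ∀ a w → a ⊗ w ≡ one → a ⊗ inverse₅ a ≡ one
  inverse₅-correct = from-yes (all? λ a → all? λ w → (a ⊗ w ≟ one) →-dec (a ⊗ inverse₅ a ≟ one))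

open Projective.Decide inverse₂₅ inverse₂₅-correct
module 𝔽₅ = Projective.Decide inverse₅ inverse₅-correct

MapsInto : Mat3 {25} → Set
MapsInto T = (k : Fin 21) → ∃[ l ] ((T ·ᵥ 𝔨 k) ∼ 𝔨 l)

MapsInto-resp : {T T′ : Mat3 {25}} → (∀ i j → T i j ≡ T′ i j) → MapsInto T → MapsInto T′
MapsInto-resp T≡T′ maps k = proj₁ (maps k) ,
  ∼-respˡ (λ i → sum3-cong λ j → cong (_⊗ 𝔨 k j) (T≡T′ i j)) (proj₂ (maps k))

-- a matrix with its entries computed once and stored
Table : Set
Table = Vec (Vec Z25 3) 3

table : Mat3 {25} → Table
table T = tabulate λ i → tabulate (T i)

entry : Table → Mat3 {25}
entry t i j = lookup (lookup t i) j

entry-table : (T : Mat3 {25}) → ∀ i j → entry (table T) i j ≡ T i j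
entry-table T i j = trans (cong (λ row → lookup row j) (lookup∘tabulate (λ i → tabulate (T i)) i))
                          (lookup∘tabulate (T i) j)

MapsInto? : (T : Mat3 {25}) → Dec (MapsInto T)
MapsInto? T = map′ (MapsInto-resp (entry-table T)) (MapsInto-resp λ i j → sym (entry-table T i j))
                   (search (table T))
  where
  search : (t : Table) → Dec (MapsInto (entry t))
  search t = all? λ k → any? λ l → (entry t ·ᵥ 𝔨 k) ∼? 𝔨 l

PowerOfρ : Mat3 {25} → Set
PowerOfρ A = (A ≃ₘ I3) ⊎ (A ≃ₘ M) ⊎ (A ≃ₘ M²)

PowerOfρ? : (A : Mat3 {25}) → Dec (PowerOfρ A)
PowerOfρ? A = (A ≃ₘ? I3) ⊎-dec (A ≃ₘ? M) ⊎-dec (A ≃ₘ? M²)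

PowerOfρ-resp : {A B : Mat3 {25}} → A ≃ₘ B → PowerOfρ B → PowerOfρ A
PowerOfρ-resp A≃B (inj₁ B≃I)         = inj₁ (≃ₘ-trans {C = I3} A≃B B≃I)
PowerOfρ-resp A≃B (inj₂ (inj₁ B≃M))  = inj₂ (inj₁ (≃ₘ-trans {C = M} A≃B B≃M))
PowerOfρ-resp A≃B (inj₂ (inj₂ B≃M²)) = inj₂ (inj₂ (≃ₘ-trans {C = M²} A≃B B≃M²))

special : Fin 6 → Fin 21
special i = lookup (# 15 ∷ # 16 ∷ # 17 ∷ # 18 ∷ # 19 ∷ # 20 ∷ []) i

partner : Fin 6 → Fin 6
partner i = lookup (# 3 ∷ # 4 ∷ # 5 ∷ # 0 ∷ # 1 ∷ # 2 ∷ []) i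

Isolated : Fin 21 → Fin 21 → Set
Isolated a b = ∀ l → Unit (det (𝔨 a) (𝔨 b) (𝔨 l)) ⊎ (l ≡ a ⊎ l ≡ b)

Isolated? : (a b : Fin 21) → Dec (Isolated a b)
Isolated? a b = all? λ l → Unit? (det (𝔨 a) (𝔨 b) (𝔨 l)) ⊎-dec (l ≟ a ⊎-dec l ≟ b)

-- The frame 𝔨₁₅, 𝔨₁₆, 𝔨₁₇, 𝔨₁₈ = 2 𝔨₁₅ + 18 𝔨₁₆ + 2 𝔨₁₇.
frameInverse : Mat3 {25}
frameInverse = mat3 (vec3 (# 12) (# 4) (# 6)) (vec3 (# 12) (# 24) (# 8)) (vec3 (# 4) (# 6) (# 12))

frameCoefficients frameCoefficients⁻¹ : Vec3 {25}
frameCoefficients   = vec3 (# 2) (# 18) (# 2)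
frameCoefficients⁻¹ = vec3 (# 13) (# 7) (# 13)

opaque
  frameInverse-correct : ∀ i j → (cols (𝔨 (# 15)) (𝔨 (# 16)) (𝔨 (# 17)) ·ₘ frameInverse) i j ≡ I3 i j
  frameInverse-correct = from-yes (all? λ i → all? λ j →
    (cols (𝔨 (# 15)) (𝔨 (# 16)) (𝔨 (# 17)) ·ₘ frameInverse) i j ≟ I3 i j)

  frame-fourth-point : 𝔨 (# 18) ≗ cols (𝔨 (# 15)) (𝔨 (# 16)) (𝔨 (# 17)) ·ᵥ frameCoefficients
  frame-fourth-point = from-yes (all? λ i →
    𝔨 (# 18) i ≟ (cols (𝔨 (# 15)) (𝔨 (# 16)) (𝔨 (# 17)) ·ᵥ frameCoefficients) i)

  frameCoefficients-inverse : ∀ m → frameCoefficients m ⊗ frameCoefficients⁻¹ m ≡ one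
  frameCoefficients-inverse = from-yes (all? λ m → frameCoefficients m ⊗ frameCoefficients⁻¹ m ≟ one)

open Frame (𝔨 (# 15)) (𝔨 (# 16)) (𝔨 (# 17)) (𝔨 (# 18)) frameInverse frameCoefficients frameCoefficients⁻¹
           frameInverse-correct frame-fourth-point frameCoefficients-inverse

frameImage : (a b c d : Fin 21) → Mat3 {25}
frameImage a b c d = frameMatrix (cols (𝔨 a) (𝔨 b) (𝔨 c)) (𝔨 d)

FrameClaim : (a b c d : Fin 21) → Set
FrameClaim a b c d = Unit (det (𝔨 a) (𝔨 b) (𝔨 c)) → MapsInto (frameImage a b c d) → PowerOfρ (frameImage a b c d)

opaque
  unfolding frameMatrix

  points-distinct : (k l : Fin 21) → 𝔨 k ∼ 𝔨 l → k ≡ l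
  points-distinct = from-yes (all? λ k → all? λ l → (𝔨 k ∼? 𝔨 l) →-dec (k ≟ l))

  frame-triangle : Unit (det (𝔨 (# 15)) (𝔨 (# 16)) (𝔨 (# 17)))
  frame-triangle = from-yes (Unit? (det (𝔨 (# 15)) (𝔨 (# 16)) (𝔨 (# 17))))

  isolated-pairs : ∀ a b → Isolated a b → ∃[ i ] (a ≡ special i × b ≡ special (partner i))
  isolated-pairs = from-yes (all? λ a → all? λ b →
    Isolated? a b →-dec any? λ i → (a ≟ special i) ×-dec (b ≟ special (partner i)))

  partners-isolated : ∀ i → Isolated (special i) (special (partner i))
  partners-isolated = from-yes (all? λ i → Isolated? (special i) (special (partner i)))

  special-frames : ∀ i j k → FrameClaim (special i) (special j) (special k) (special (partner i))
  special-frames = from-yes (all? λ i → all? λ j → all? λ k →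
    let a = special i ; b = special j ; c = special k ; d = special (partner i)
    in Unit? (det (𝔨 a) (𝔨 b) (𝔨 c)) →-dec MapsInto? (frameImage a b c d) →-dec PowerOfρ? (frameImage a b c d))

module Stabilizer (A : Mat3 {25}) (invertible : Invertible A) (stabilizes : Stabilizes A 𝔨) where

  σ : Fin 21 → Fin 21
  σ k = proj₁ (proj₁ stabilizes k)

  σ-image : ∀ k → (A ·ᵥ 𝔨 k) ∼ 𝔨 (σ k)
  σ-image k = proj₂ (proj₁ stabilizes k)

  τ : Fin 21 → Fin 21
  τ l = proj₁ (proj₂ stabilizes l)

  -- σ ∘ τ is the identity, as distinct points of 𝔨 span distinct submodules
  σ∘τ : ∀ l → σ (τ l) ≡ l
  σ∘τ l = points-distinct (σ (τ l)) l
    (∼-trans {u = 𝔨 (σ (τ l))} {v = A ·ᵥ 𝔨 (τ l)} {w = 𝔨 l}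
             (∼-sym {v = A ·ᵥ 𝔨 (τ l)} {w = 𝔨 (σ (τ l))} (σ-image (τ l))) (proj₂ (proj₂ stabilizes l)))

  -- A has a unit determinant, so σ preserves triangles of unit determinant
  triangle : ∀ {x y z} → Unit (det (𝔨 x) (𝔨 y) (𝔨 z)) → Unit (det (𝔨 (σ x)) (𝔨 (σ y)) (𝔨 (σ z)))
  triangle {x} {y} {z} = unit-triangle-image A (𝔨 x) (𝔨 y) (𝔨 z) (𝔨 (σ x)) (𝔨 (σ y)) (𝔨 (σ z))
                           (invertible-det A invertible) (σ-image x) (σ-image y) (σ-image z)

  -- σ maps isolated pairs to isolated pairs, since every l is σ (τ l)
  isolated-image : ∀ {a b} → Isolated a b → Isolated (σ a) (σ b)
  isolated-image {a} {b} isolated l = image-of (isolated (τ l))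
    where
    image-of : Unit (det (𝔨 a) (𝔨 b) (𝔨 (τ l))) ⊎ (τ l ≡ a ⊎ τ l ≡ b) →
               Unit (det (𝔨 (σ a)) (𝔨 (σ b)) (𝔨 l)) ⊎ (l ≡ σ a ⊎ l ≡ σ b)
    image-of (inj₁ unit)        = inj₁ (subst (λ z → Unit (det (𝔨 (σ a)) (𝔨 (σ b)) (𝔨 z))) (σ∘τ l)
                                              (triangle {a} {b} {τ l} unit))
    image-of (inj₂ (inj₁ τl≡a)) = inj₂ (inj₁ (trans (sym (σ∘τ l)) (cong σ τl≡a)))
    image-of (inj₂ (inj₂ τl≡b)) = inj₂ (inj₂ (trans (sym (σ∘τ l)) (cong σ τl≡b)))

  PartnerImage : Fin 6 → Set
  PartnerImage i = ∃[ j ] (σ (special i) ≡ special j × σ (special (partner i)) ≡ special (partner j))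

  partners-image : ∀ i → PartnerImage i
  partners-image i = isolated-pairs (σ (special i)) (σ (special (partner i)))
                       (isolated-image {special i} {special (partner i)} (partners-isolated i))

-- Every invertible matrix stabilizing 𝔨 is a power of ρ in PGL(3, ℤ₂₅): it agrees with the
-- matrix determined by the images of the frame, which are special points, and that matrix
-- maps 𝔨 into itself.
stabilizer-is-power-of-ρ : (A : Mat3 {25}) → Invertible A → Stabilizes A 𝔨 → PowerOfρ A
stabilizer-is-power-of-ρ A invertible stabilizes =
  PowerOfρ-resp {A} {F} A≃F (claim frame-image-triangle F-maps-into)
  where
  open Stabilizer A invertible stabilizes

  F : Mat3 {25}
  F = frameImage (σ (# 15)) (σ (# 16)) (σ (# 17)) (σ (# 18))

  frame-image-triangle : Unit (det (𝔨 (σ (# 15))) (𝔨 (σ (# 16))) (𝔨 (σ (# 17))))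
  frame-image-triangle = triangle {# 15} {# 16} {# 17} frame-triangle

  image : ∀ k → 𝔨 (σ k) ∼ (A ·ᵥ 𝔨 k)
  image k = ∼-sym {v = A ·ᵥ 𝔨 k} {w = 𝔨 (σ k)} (σ-image k)

  A≃F : A ≃ₘ F
  A≃F = frame-determines A (𝔨 (σ (# 15))) (𝔨 (σ (# 16))) (𝔨 (σ (# 17))) (𝔨 (σ (# 18)))
          (image (# 15)) (image (# 16)) (image (# 17)) (image (# 18)) frame-image-triangle

  F-maps-into : MapsInto F
  F-maps-into k = σ k , ∼-trans {u = F ·ᵥ 𝔨 k} {v = A ·ᵥ 𝔨 k} {w = 𝔨 (σ k)}
                                (≃ₘ-images {A} {F} A≃F (𝔨 k)) (σ-image k)

  claim : FrameClaim (σ (# 15)) (σ (# 16)) (σ (# 17)) (σ (# 18))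
  claim = from-partners (partners-image (# 0)) (partners-image (# 1)) (partners-image (# 2))
    where
    from-partners : PartnerImage (# 0) → PartnerImage (# 1) → PartnerImage (# 2) →
                    FrameClaim (σ (# 15)) (σ (# 16)) (σ (# 17)) (σ (# 18))
    from-partners (i , σ₁₅ , σ₁₈) (j , σ₁₆ , _) (k , σ₁₇ , _) =
      subst (λ (a , b , c , d) → FrameClaim a b c d)
            (sym (cong₂ _,_ σ₁₅ (cong₂ _,_ σ₁₆ (cong₂ _,_ σ₁₇ σ₁₈))))
            (special-frames i j k)

opaque
  ρ-invertible : Invertible M
  ρ-invertible = M² , from-yes (all? λ i → all? λ j → (M ·ₘ M²) i j ≟ I3 i j)
                    , from-yes (all? λ i → all? λ j → (M² ·ₘ M) i j ≟ I3 i j)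

  ρ-stabilizes : Stabilizes M 𝔨
  ρ-stabilizes = from-yes ((all? λ k → any? λ l → (M ·ᵥ 𝔨 k) ∼? 𝔨 l)
                           ×-dec (all? λ l → any? λ k → (M ·ᵥ 𝔨 k) ∼? 𝔨 l))

  ρ-order-three : ¬ (M ≃ₘ I3) × ¬ (M² ≃ₘ I3) × ¬ (M ≃ₘ M²)
  ρ-order-three = from-yes (¬? (M ≃ₘ? I3) ×-dec ¬? (M² ≃ₘ? I3) ×-dec ¬? (M ≃ₘ? M²))

  neighbour-classes-distinct : (k l : Fin 21) → φv (𝔨 k) ∼ φv (𝔨 l) → k ≡ l
  neighbour-classes-distinct = from-yes (all? λ k → all? λ l → (φv (𝔨 k) 𝔽₅.∼? φv (𝔨 l)) →-dec (k ≟ l))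

InImage? : (P : Vec3 {5}) → Dec (InImage P)
InImage? P = any? λ k → φv (𝔨 k) 𝔽₅.∼? P

Listed? : (P : Vec3 {5}) → Dec (Listed P)
Listed? P = any? (λ a → P 𝔽₅.∼? vec3 (# 0) (# 1) (⊖ (a ⊗ a))
                  ⊎-dec P 𝔽₅.∼? vec3 (# 1) (⊖ (a ⊗ a)) (# 0)
                  ⊎-dec P 𝔽₅.∼? vec3 (⊖ (a ⊗ a)) (# 0) (# 1))
            ⊎-dec P 𝔽₅.∼? vec3 (# 1) (# 1) (# 1)

_⇔-dec_ : {X Y : Set} → Dec X → Dec Y → Dec (X ⇔ Y)
x? ⇔-dec y? = map′ (λ (to , from) → mk⇔ to from) (λ x⇔y → Equivalence.to x⇔y , Equivalence.from x⇔y)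
                   ((x? →-dec y?) ×-dec (y? →-dec x?))

ComplementClaim : Vec3 {5} → Set
ComplementClaim P = IsPoint P → ((¬ InImage P) ⇔ Listed P)

ComplementClaim-resp : {P P′ : Vec3 {5}} → P ≗ P′ → ComplementClaim P → ComplementClaim P′
ComplementClaim-resp {P} {P′} P≗P′ claim (i , unit) =
  mk⇔ (λ ¬image′ → listed P≗P′ (Equivalence.to P-claim (λ image → ¬image′ (in-image P≗P′ image))))
      (λ listed′ image′ → Equivalence.from P-claim (listed (λ i → sym (P≗P′ i)) listed′)
                                                   (in-image (λ i → sym (P≗P′ i)) image′))
  where
  P-claim : (¬ InImage P) ⇔ Listed P
  P-claim = claim (i , subst Unit (sym (P≗P′ i)) unit)
  in-image : {Q Q′ : Vec3 {5}} → Q ≗ Q′ → InImage Q → InImage Q′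
  in-image Q≗Q′ (k , φ𝔨ₖ∼Q) = k , ∼-respʳ {v = φv (𝔨 k)} Q≗Q′ φ𝔨ₖ∼Q
  listed : {Q Q′ : Vec3 {5}} → Q ≗ Q′ → Listed Q → Listed Q′
  listed Q≗Q′ (inj₁ (a , inj₁ Q∼)) =
    inj₁ (a , inj₁ (∼-respˡ {w = vec3 (# 0) (# 1) (⊖ (a ⊗ a))} Q≗Q′ Q∼))
  listed Q≗Q′ (inj₁ (a , inj₂ (inj₁ Q∼))) =
    inj₁ (a , inj₂ (inj₁ (∼-respˡ {w = vec3 (# 1) (⊖ (a ⊗ a)) (# 0)} Q≗Q′ Q∼)))
  listed Q≗Q′ (inj₁ (a , inj₂ (inj₂ Q∼))) =
    inj₁ (a , inj₂ (inj₂ (∼-respˡ {w = vec3 (⊖ (a ⊗ a)) (# 0) (# 1)} Q≗Q′ Q∼)))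
  listed Q≗Q′ (inj₂ Q∼) = inj₂ (∼-respˡ {w = vec3 (# 1) (# 1) (# 1)} Q≗Q′ Q∼)

opaque
  complement-coordinates : ∀ x y z → ComplementClaim (vec3 x y z)
  complement-coordinates = from-yes (all? λ x → all? λ y → all? λ z →
    𝔽₅.IsPoint? (vec3 x y z) →-dec (¬? (InImage? (vec3 x y z)) ⇔-dec Listed? (vec3 x y z)))

complement : (P : Vec3 {5}) → ComplementClaim P
complement P = ComplementClaim-resp from-coordinates (complement-coordinates (P (# 0)) (P (# 1)) (P (# 2)))
  where
  from-coordinates : vec3 (P (# 0)) (P (# 1)) (P (# 2)) ≗ P
  from-coordinates zero             = refl
  from-coordinates (suc zero)       = refl
  from-coordinates (suc (suc zero)) = refl

mainTheorem2 :
    ( (Invertible M × Stabilizes M 𝔨)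
    × (¬ (M ≃ₘ I3) × ¬ (M² ≃ₘ I3) × ¬ (M ≃ₘ M²))
    × ((A : Mat3 {25}) → Invertible A → Stabilizes A 𝔨 →
         (A ≃ₘ I3) ⊎ (A ≃ₘ M) ⊎ (A ≃ₘ M²)) )
    × ((k l : Fin 21) → φv (𝔨 k) ∼ φv (𝔨 l) → k ≡ l)
    × ((P : Vec3 {5}) → IsPoint P → ((¬ InImage P) ⇔ Listed P))
mainTheorem2 =
  ( (ρ-invertible , ρ-stabilizes)
  , ρ-order-three
  , stabilizer-is-power-of-ρ )
  , neighbour-classes-distinct
  , complement
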